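{- (Soundness of the contextual denotation.) For every typing context $\Gamma$, term $r$, type $A$ and valuation $\varsigma$: if $\Gamma\vdash r:A$ and $\Gamma\vdash\varsigma$, then $[\![r]\!]_\varsigma\in[\![A]\!]$.
   Context: Contextual modal type system. Fix disjoint countably infinite sets $\mathbb A$ of atoms and $\mathbb X$ of unknowns. Types: $A::=o\mid\mathbb N\mid A\to A\mid [A_1,\dots,A_n]A$ ($n\ge0$). Fix a set of constants $C$ each with type $\mathrm{type}(C)$, including $\top:o$, $\bot:o$ and, for each type $A$, $\mathrm{isapp}_A:[\,]A\to o$. Terms: $r::=C\mid a\mid\lambda a{:}A.r\mid rr\mid [a_1{:}A_1,\dots,a_n{:}A_n]r\mid X@(r_1,\dots,r_n)\mid \mathrm{letbox}\ X=s\ \mathrm{in}\ r$; $\lambda a{:}A.r$ binds $a$, $[a_i{:}A_i]r$ binds $a_1,\dots,a_n$, and letbox binds $X$ in $r$; terms up to $\alpha$-equivalence. Free atoms: $\mathrm{fa}(C)=\emptyset$, $\mathrm{fa}(a)=\{a\}$, $\mathrm{fa}(\lambda a{:}A.r)=\mathrm{fa}(r)\setminus\{a\}$, $\mathrm{fa}(rs)=\mathrm{fa}(r)\cup\mathrm{fa}(s)$, $\mathrm{fa}([a_i{:}A_i]_1^nr)=\mathrm{fa}(r)\setminus\{a_1,\dots,a_n\}$, $\mathrm{fa}(\mathrm{letbox}\ X=s\ \mathrm{in}\ r)=\mathrm{fa}(r)\cup\mathrm{fa}(s)$, $\mathrm{fa}(X@(s_i)_i)=\bigcup_i\mathrm{fa}(s_i)$.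 Free unknowns: $\mathrm{fv}(C)=\mathrm{fv}(a)=\emptyset$, $\mathrm{fv}(\lambda a{:}A.r)=\mathrm{fv}([a_i{:}A_i]r)=\mathrm{fv}(r)$, $\mathrm{fv}(rs)=\mathrm{fv}(r)\cup\mathrm{fv}(s)$, $\mathrm{fv}(\mathrm{letbox}\ X=s\ \mathrm{in}\ r)=(\mathrm{fv}(r)\setminus\{X\})\cup\mathrm{fv}(s)$, $\mathrm{fv}(X@(s_i)_i)=\{X\}\cup\bigcup_i\mathrm{fv}(s_i)$. A typing context $\Gamma$ is a finite partial function from $\mathbb A\cup\mathbb X$ to types (unknowns receive contextual types). Typing rules: (Hyp) $\Gamma,a{:}A\vdash a:A$; (Const) $\Gamma\vdash C:\mathrm{type}(C)$; (${\to}$I) from $\Gamma,a{:}A\vdash r:B$ infer $\Gamma\vdash\lambda a{:}A.r:A\to B$; (${\to}$E) from $\Gamma\vdash r':A\to B$, $\Gamma\vdash r:A$ infer $\Gamma\vdash r'r:B$; ([]I) from $\Gamma,a_1{:}A_1,\dots,a_n{:}A_n\vdash r:A$ and $\mathrm{fa}(r)\subseteq\{a_1,\dots,a_n\}$ infer $\Gamma\vdash[a_i{:}A_i]r:[A_i]A$; ([]E) from $\Gamma,X{:}[A_i]A\vdash r:B$ and $\Gamma\vdash s:[A_i]A$ infer $\Gamma\vdash\mathrm{letbox}\ X=s\ \mathrm{in}\ r:B$; (Ext) if $\Gamma,X{:}[A_1,\dots,A_n]A\vdash r_j:A_j$ for $1\le j\le n$ then $\Gamma,X{:}[A_1,\dots,A_n]A\vdash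 X@(r_1,\dots,r_n):A$. Substitutions: an atoms-substitution $\sigma$ is a finite partial map $\mathbb A\to$ terms, $\mathrm{fa}(\sigma)=\mathrm{dom}\sigma\cup\bigcup_{a}\mathrm{fa}(\sigma(a))$; action: $C\sigma=C$, $a\sigma=\sigma(a)$ if $a\in\mathrm{dom}\sigma$ else $a$, $(rs)\sigma=(r\sigma)(s\sigma)$, $(X@(r_i))\sigma=X@(r_i\sigma)$, $(\lambda c{:}A.r)\sigma=\lambda c{:}A.(r\sigma)$ ($c\notin\mathrm{fa}(\sigma)$), $([a_i{:}A_i]r)\sigma=[a_i{:}A_i](r\sigma)$ ($a_i\notin\mathrm{fa}(\sigma)$), $(\mathrm{letbox}\ Y=s\ \mathrm{in}\ r)\sigma=\mathrm{letbox}\ Y=s\sigma\ \mathrm{in}\ r\sigma$. An unknowns-substitution $\theta$ is a finite partial map $\mathbb X\to$ terms with each $\theta(X)=[a_1{:}A_1,\dots,a_n{:}A_n]r$, $\mathrm{fa}(r)\subseteq\{a_1,\dots,a_n\}$; action: $C\theta=C$, $a\theta=a$, $(rs)\theta=(r\theta)(s\theta)$, $([a_i{:}A_i]r)\theta=[a_i{:}A_i](r\theta)$, $(\lambda c{:}A.r)\theta=\lambda c{:}A.(r\theta)$, $(X@(r_i)_i)\theta=s'[a_i{:=}r_i\theta]_i$ (simultaneous atoms-substitution) if $\theta(X)=[a_i{:}A_i]s'$ with matching arity, $(X@(r_i))\theta=X@(r_i\theta)$ if $X\notin\mathrm{dom}\theta$, $(\mathrm{letbox}\ Y=s\ \mathrm{in}\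 r)\theta=\mathrm{letbox}\ Y=s\theta\ \mathrm{in}\ r\theta$ ($Y\notin\mathrm{fv}(\theta)$). Denotation: $[\![o]\!]=\{\top,\bot\}$, $[\![\mathbb N]\!]=\mathbb N$, $[\![A\to B]\!]$ = all functions $[\![A]\!]\to[\![B]\!]$, $[\![[A_1,\dots,A_n]A]\!]=\{[a_i{:}A_i]_1^nr\mid\emptyset\vdash[a_i{:}A_i]_1^nr:[A_i]_1^nA\}\times(\text{all functions }\prod_{i=1}^n[\![A_i]\!]\to[\![A]\!])$; pairs written $h::f$ with $\mathrm{hd}$, $\mathrm{tl}$ the projections. A valuation $\varsigma$ is a finite partial function on $\mathbb A\cup\mathbb X$; $\Gamma\vdash\varsigma$ means $\mathrm{dom}\Gamma=\mathrm{dom}\varsigma$, $\varsigma(a)\in[\![\Gamma(a)]\!]$ and $\varsigma(X)\in[\![\Gamma(X)]\!]$. $\varsigma_{\mathbb X}$ is the unknowns-substitution $X\mapsto\mathrm{hd}(\varsigma(X))$. Each other constant $C$ has a fixed $C^{[\![]\!]}\in[\![\mathrm{type}(C)]\!]$. Terms: $[\![\top]\!]_\varsigma=\top$, $[\![\bot]\!]_\varsigma=\bot$, $[\![C]\!]_\varsigma=C^{[\![]\!]}$, $[\![a]\!]_\varsigma=\varsigma(a)$, $[\![\lambda a{:}A.r]\!]_\varsigma=(x\mapsto[\![r]\!]_{\varsigma[a:=x]})$, $[\![r'r]\!]_\varsigma=[\![r']\!]_\varsigma([\![r]\!]_\varsigma)$, $[\![[a_i{:}A_i]_1^nr]\!]_\varsigma=[a_i{:}A_i]_1^n(r\varsigma_{\mathbb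 X})::\big((x_i\in[\![A_i]\!])_1^n\mapsto[\![r]\!]_{\varsigma[a_i:=x_i]_1^n}\big)$, $[\![X@(r_i)_1^n]\!]_\varsigma=\mathrm{tl}(\varsigma(X))([\![r_1]\!]_\varsigma,\dots,[\![r_n]\!]_\varsigma)$, $[\![\mathrm{letbox}\ X=s\ \mathrm{in}\ r]\!]_\varsigma=[\![r]\!]_{\varsigma[X:=[\![s]\!]_\varsigma]}$, and $[\![\mathrm{isapp}_A]\!]$ maps $[a_i{:}A_i](r'r'')::f$ to $\top$ and every other element to $\bot$. -}

module Defs where

-- Contextual modal type system: syntax, typing, denotation.
-- Conventions: de Bruijn indices for atoms and unknowns;
-- a context Γ is split into an unknowns part Δ and an atoms part Φ.

open import Data.Nat using (ℕ; zero; suc)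
open import Data.Bool using (Bool; true; false)
open import Data.Unit using (⊤; tt)
open import Data.Product using (Σ; _×_; _,_; proj₁; proj₂)
open import Data.List using (List; []; _∷_)
open import Data.Maybe using (Maybe; just; nothing; _>>=_; fromMaybe)
import Data.Maybe as Maybe
open import Data.List.Relation.Binary.Pointwise using (Pointwise)
open import Relation.Binary.PropositionalEquality using (_≡_)

data Ty : Set where
  o    : Ty
  nat  : Ty
  _⇒_  : Ty → Ty → Ty
  box  : List Ty → Ty → Ty

infixr 5 _⇒_

nth : {X : Set} → List X → ℕ → Maybe X
nth []       _       = nothing
nth (x ∷ xs) zero    = just x
nth (x ∷ xs) (suc i) = nth xs i

-- The set C of (non-built-in) constants with their types.
-- ⊤, ⊥ and isapp_A are built into the term syntax below.
record Signature : Set₁ where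
  field
    Const : Set
    ctype : Const → Ty

module Lang (S : Signature) where
  open Signature S public

  -- Atoms and unknowns are de Bruijn indices.
  --   lam A r     : λ a:A. r          (binds atom 0 in r)
  --   box As r    : [a₁:A₁,…,aₙ:Aₙ] r  (the atoms of r are exactly a₁…aₙ, index i ↦ a_{i+1})
  --   mvar X rs   : X@(r₁,…,rₙ)
  --   letbox s r  : letbox X = s in r  (binds unknown 0 in r)
  data Tm : Set where
    con    : Const → Tm
    top    : Tm
    bot    : Tm
    isapp  : Ty → Tm
    atom   : ℕ → Tm
    lam    : Ty → Tm → Tm
    app    : Tm → Tm → Tm
    box    : List Ty → Tm → Tm
    mvar   : ℕ → List Tm → Tm
    letbox : Tm → Tm → Tm

  -- contexts: unknowns get contextual types [As]A, atoms get types
  MCtx : Set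
  MCtx = List (List Ty × Ty)

  infix 4 _∣_⊢_∶_ _∣_⊢*_∶_

  data _∣_⊢_∶_ : MCtx → List Ty → Tm → Ty → Set
  data _∣_⊢*_∶_ : MCtx → List Ty → List Tm → List Ty → Set

  data _∣_⊢_∶_ where
    t-hyp    : ∀ {Δ Φ i A} → nth Φ i ≡ just A → Δ ∣ Φ ⊢ atom i ∶ A
    t-con    : ∀ {Δ Φ} c → Δ ∣ Φ ⊢ con c ∶ ctype c
    t-top    : ∀ {Δ Φ} → Δ ∣ Φ ⊢ top ∶ o
    t-bot    : ∀ {Δ Φ} → Δ ∣ Φ ⊢ bot ∶ o
    t-isapp  : ∀ {Δ Φ} A → Δ ∣ Φ ⊢ isapp A ∶ (box [] A ⇒ o)
    t-lam    : ∀ {Δ Φ A B r} → Δ ∣ (A ∷ Φ) ⊢ r ∶ B → Δ ∣ Φ ⊢ lam A r ∶ (A ⇒ B)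
    t-app    : ∀ {Δ Φ A B r′ r} → Δ ∣ Φ ⊢ r′ ∶ (A ⇒ B) → Δ ∣ Φ ⊢ r ∶ A → Δ ∣ Φ ⊢ app r′ r ∶ B
    -- ([]I): the body may only use the box-bound atoms (fa(r) ⊆ {a₁,…,aₙ})
    t-box    : ∀ {Δ Φ As A r} → Δ ∣ As ⊢ r ∶ A → Δ ∣ Φ ⊢ box As r ∶ box As A
    t-letbox : ∀ {Δ Φ As A B s r} → ((As , A) ∷ Δ) ∣ Φ ⊢ r ∶ B → Δ ∣ Φ ⊢ s ∶ box As A
             → Δ ∣ Φ ⊢ letbox s r ∶ B
    t-ext    : ∀ {Δ Φ X As A rs} → nth Δ X ≡ just (As , A) → Δ ∣ Φ ⊢* rs ∶ As
             → Δ ∣ Φ ⊢ mvar X rs ∶ A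

  data _∣_⊢*_∶_ where
    t-nil  : ∀ {Δ Φ} → Δ ∣ Φ ⊢* [] ∶ []
    t-cons : ∀ {Δ Φ r rs A As} → Δ ∣ Φ ⊢ r ∶ A → Δ ∣ Φ ⊢* rs ∶ As → Δ ∣ Φ ⊢* (r ∷ rs) ∶ (A ∷ As)

  liftR : (ℕ → ℕ) → ℕ → ℕ
  liftR ρ zero    = zero
  liftR ρ (suc i) = suc (ρ i)

  -- renaming of atoms (box bodies have no outer atoms, so are untouched)
  renA  : (ℕ → ℕ) → Tm → Tm
  renA* : (ℕ → ℕ) → List Tm → List Tm
  renA ρ (con c)      = con c
  renA ρ top          = top
  renA ρ bot          = bot
  renA ρ (isapp A)    = isapp A
  renA ρ (atom i)     = atom (ρ i)
  renA ρ (lam A r)    = lam A (renA (liftR ρ) r)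
  renA ρ (app r s)    = app (renA ρ r) (renA ρ s)
  renA ρ (box As r)   = box As r
  renA ρ (mvar X rs)  = mvar X (renA* ρ rs)
  renA ρ (letbox s r) = letbox (renA ρ s) (renA ρ r)
  renA* ρ []       = []
  renA* ρ (r ∷ rs) = renA ρ r ∷ renA* ρ rs

  renU  : (ℕ → ℕ) → Tm → Tm
  renU* : (ℕ → ℕ) → List Tm → List Tm
  renU ρ (con c)      = con c
  renU ρ top          = top
  renU ρ bot          = bot
  renU ρ (isapp A)    = isapp A
  renU ρ (atom i)     = atom i
  renU ρ (lam A r)    = lam A (renU ρ r)
  renU ρ (app r s)    = app (renU ρ r) (renU ρ s)
  renU ρ (box As r)   = box As (renU ρ r)
  renU ρ (mvar X rs)  = mvar (ρ X) (renU* ρ rs)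
  renU ρ (letbox s r) = letbox (renU ρ s) (renU (liftR ρ) r)
  renU* ρ []       = []
  renU* ρ (r ∷ rs) = renU ρ r ∷ renU* ρ rs

  liftS : (ℕ → Tm) → ℕ → Tm
  liftS σ zero    = atom zero
  liftS σ (suc i) = renA suc (σ i)

  subA  : (ℕ → Tm) → Tm → Tm
  subA* : (ℕ → Tm) → List Tm → List Tm
  subA σ (con c)      = con c
  subA σ top          = top
  subA σ bot          = bot
  subA σ (isapp A)    = isapp A
  subA σ (atom i)     = σ i
  subA σ (lam A r)    = lam A (subA (liftS σ) r)
  subA σ (app r s)    = app (subA σ r) (subA σ s)
  subA σ (box As r)   = box As r
  subA σ (mvar X rs)  = mvar X (subA* σ rs)
  subA σ (letbox s r) = letbox (subA σ s) (subA (λ i → renU suc (σ i)) r)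
  subA* σ []       = []
  subA* σ (r ∷ rs) = subA σ r ∷ subA* σ rs

  argsSub : List Tm → ℕ → Tm
  argsSub ts i = fromMaybe (atom i) (nth ts i)

  -- unknowns-substitution: θ X = just r means θ(X) = [a₁…aₙ] r
  liftM : (ℕ → Maybe Tm) → ℕ → Maybe Tm
  liftM θ zero    = nothing
  liftM θ (suc i) = Maybe.map (renU suc) (θ i)

  mvarSub : Maybe Tm → ℕ → List Tm → Tm
  mvarSub (just b) X ts = subA (argsSub ts) b
  mvarSub nothing  X ts = mvar X ts

  subU  : (ℕ → Maybe Tm) → Tm → Tm
  subU* : (ℕ → Maybe Tm) → List Tm → List Tm
  subU θ (con c)      = con c
  subU θ top          = top
  subU θ bot          = bot
  subU θ (isapp A)    = isapp A
  subU θ (atom i)     = atom i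
  subU θ (lam A r)    = lam A (subU θ r)
  subU θ (app r s)    = app (subU θ r) (subU θ s)
  subU θ (box As r)   = box As (subU θ r)
  subU θ (mvar X rs)  = mvarSub (θ X) X (subU* θ rs)
  subU θ (letbox s r) = letbox (subU θ s) (subU (liftM θ) r)
  subU* θ []       = []
  subU* θ (r ∷ rs) = subU θ r ∷ subU* θ rs

  -- {[aᵢ:Aᵢ] r | ∅ ⊢ [aᵢ:Aᵢ] r : [Aᵢ]A}, represented by the body r
  Closed : List Ty → Ty → Set
  Closed As A = Σ Tm (λ r → [] ∣ [] ⊢ box As r ∶ box As A)

  Sem  : Ty → Set
  Sems : List Ty → Set
  Sem o          = Bool      -- true = ⊤, false = ⊥
  Sem nat        = ℕ
  Sem (A ⇒ B)    = Sem A → Sem B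
  Sem (box As A) = Closed As A × (Sems As → Sem A)   -- hd :: tl
  Sems []       = ⊤
  Sems (A ∷ As) = Sem A × Sems As

  -- the (untyped) universe of semantic values: v ∈ ⟦A⟧ is a value tagged A
  U : Set
  U = Σ Ty Sem

  toVals : (As : List Ty) → Sems As → List U
  toVals []       _        = []
  toVals (A ∷ As) (x , xs) = (A , x) ∷ toVals As xs

  -- valuations: (values of atoms , values of unknowns)
  Val : Set
  Val = List U × List U

  infix 4 _∣_⊢ᵥ_
  _∣_⊢ᵥ_ : MCtx → List Ty → Val → Set
  Δ ∣ Φ ⊢ᵥ ς = Pointwise (λ A u → proj₁ u ≡ A) Φ (proj₁ ς)
             × Pointwise (λ C u → proj₁ u ≡ box (proj₁ C) (proj₂ C)) Δ (proj₂ ς)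

  hdBody : U → Maybe Tm
  hdBody (o , _)        = nothing
  hdBody (nat , _)      = nothing
  hdBody (_ ⇒ _ , _)    = nothing
  hdBody (box As A , v) = just (proj₁ (proj₁ v))

  ςX : List U → ℕ → Maybe Tm
  ςX us X = nth us X >>= hdBody

  isApp : Tm → Bool
  isApp (app _ _) = true
  isApp _         = false

  -- Denotation of terms, as a (big-step) relation  ς ⊨ r ⇓ v  meaning ⟦r⟧_ς = v
  module Denot (interp : (c : Const) → Sem (ctype c)) where

    infix 4 _⊨_⇓_ _⊨*_⇓_∶_

    data _⊨_⇓_ : Val → Tm → U → Set
    data _⊨*_⇓_∶_ : Val → List Tm → (As : List Ty) → Sems As → Set

    data _⊨_⇓_ where
      ev-top   : ∀ {ς} → ς ⊨ top ⇓ (o , true)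
      ev-bot   : ∀ {ς} → ς ⊨ bot ⇓ (o , false)
      ev-con   : ∀ {ς} c → ς ⊨ con c ⇓ (ctype c , interp c)
      ev-isapp : ∀ {ς} A → ς ⊨ isapp A ⇓ (box [] A ⇒ o , λ v → isApp (proj₁ (proj₁ v)))
      ev-atom  : ∀ {ς i u} → nth (proj₁ ς) i ≡ just u → ς ⊨ atom i ⇓ u
      ev-lam   : ∀ {ς A B r} {f : Sem A → Sem B}
               → (∀ x → ((A , x) ∷ proj₁ ς , proj₂ ς) ⊨ r ⇓ (B , f x))
               → ς ⊨ lam A r ⇓ (A ⇒ B , f)
      ev-app   : ∀ {ς A B r′ r f x} → ς ⊨ r′ ⇓ (A ⇒ B , f) → ς ⊨ r ⇓ (A , x)
               → ς ⊨ app r′ r ⇓ (B , f x)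
      ev-box   : ∀ {ς As A r} {f : Sems As → Sem A}
               → (pf : [] ∣ [] ⊢ box As (subU (ςX (proj₂ ς)) r) ∶ box As A)
               → (∀ xs → (toVals As xs , proj₂ ς) ⊨ r ⇓ (A , f xs))
               → ς ⊨ box As r ⇓ (box As A , ((subU (ςX (proj₂ ς)) r , pf) , f))
      ev-ext   : ∀ {ς X rs As A h f xs}
               → nth (proj₂ ς) X ≡ just (box As A , (h , f))
               → ς ⊨* rs ⇓ As ∶ xs
               → ς ⊨ mvar X rs ⇓ (A , f xs)
      ev-letbox : ∀ {ς s r u v} → ς ⊨ s ⇓ u → (proj₁ ς , u ∷ proj₂ ς) ⊨ r ⇓ v
                → ς ⊨ letbox s r ⇓ v

    data _⊨*_⇓_∶_ where
      ev-nil  : ∀ {ς} → ς ⊨* [] ⇓ [] ∶ tt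
      ev-cons : ∀ {ς r rs A As x xs} → ς ⊨ r ⇓ (A , x) → ς ⊨* rs ⇓ As ∶ xs
              → ς ⊨* (r ∷ rs) ⇓ (A ∷ As) ∶ (x , xs)

module Submission where

-- Every case is direct
-- except ([]I): the denotation of a box [aᵢ:Aᵢ] r carries, as its head, the
-- syntactic body r ς_𝕏, and that head must itself be a closed, well-typed
-- box.

open import Defs
open import Data.Product using (Σ; _,_; _×_; proj₁; proj₂)
open import Data.List using (List; []; _∷_)
open import Data.Nat using (ℕ; zero; suc)
open import Data.Maybe using (Maybe; just; nothing)
import Data.Maybe as Maybe
open import Data.Unit using (tt)
open import Data.List.Relation.Binary.Pointwise using (Pointwise; []; _∷_)
open import Relation.Binary.PropositionalEquality using (_≡_; refl)

lookup-pointwise : {X Y : Set} {R : X → Y → Set} {xs : List X} {ys : List Y} (i : ℕ) {x : X} →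
  Pointwise R xs ys → nth xs i ≡ just x → Σ Y (λ y → nth ys i ≡ just y × R x y)
lookup-pointwise zero    (r ∷ _) refl = _ , refl , r
lookup-pointwise (suc i) (_ ∷ p) e    = lookup-pointwise i p e

Renames : {X : Set} → List X → List X → (ℕ → ℕ) → Set
Renames xs ys ρ = ∀ i {x} → nth xs i ≡ just x → nth ys (ρ i) ≡ just x

module Metatheory (S : Signature) where
  open Lang S

  lift-renames : {X : Set} {xs ys : List X} {ρ : ℕ → ℕ} (x : X) →
    Renames xs ys ρ → Renames (x ∷ xs) (x ∷ ys) (liftR ρ)
  lift-renames x h zero    e = e
  lift-renames x h (suc i) e = h i e

  -- Renaming atoms preserves typing (box bodies are closed, hence untouched).
  renA-typed  : ∀ {Δ Φ Φ′ r A} (ρ : ℕ → ℕ) → Renames Φ Φ′ ρ →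
                Δ ∣ Φ ⊢ r ∶ A → Δ ∣ Φ′ ⊢ renA ρ r ∶ A
  renA*-typed : ∀ {Δ Φ Φ′ rs As} (ρ : ℕ → ℕ) → Renames Φ Φ′ ρ →
                Δ ∣ Φ ⊢* rs ∶ As → Δ ∣ Φ′ ⊢* renA* ρ rs ∶ As
  renA-typed ρ h (t-hyp {i = i} e)  = t-hyp (h i e)
  renA-typed ρ h (t-con c)          = t-con c
  renA-typed ρ h t-top              = t-top
  renA-typed ρ h t-bot              = t-bot
  renA-typed ρ h (t-isapp A)        = t-isapp A
  renA-typed ρ h (t-lam {A = A} d)  = t-lam (renA-typed (liftR ρ) (lift-renames A h) d)
  renA-typed ρ h (t-app d d′)       = t-app (renA-typed ρ h d) (renA-typed ρ h d′)
  renA-typed ρ h (t-box d)          = t-box d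
  renA-typed ρ h (t-letbox d d′)    = t-letbox (renA-typed ρ h d) (renA-typed ρ h d′)
  renA-typed ρ h (t-ext e ds)       = t-ext e (renA*-typed ρ h ds)
  renA*-typed ρ h t-nil         = t-nil
  renA*-typed ρ h (t-cons d ds) = t-cons (renA-typed ρ h d) (renA*-typed ρ h ds)

  renU-typed  : ∀ {Δ Δ′ Φ r A} (ρ : ℕ → ℕ) → Renames Δ Δ′ ρ →
                Δ ∣ Φ ⊢ r ∶ A → Δ′ ∣ Φ ⊢ renU ρ r ∶ A
  renU*-typed : ∀ {Δ Δ′ Φ rs As} (ρ : ℕ → ℕ) → Renames Δ Δ′ ρ →
                Δ ∣ Φ ⊢* rs ∶ As → Δ′ ∣ Φ ⊢* renU* ρ rs ∶ As
  renU-typed ρ h (t-hyp e)          = t-hyp e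
  renU-typed ρ h (t-con c)          = t-con c
  renU-typed ρ h t-top              = t-top
  renU-typed ρ h t-bot              = t-bot
  renU-typed ρ h (t-isapp A)        = t-isapp A
  renU-typed ρ h (t-lam d)          = t-lam (renU-typed ρ h d)
  renU-typed ρ h (t-app d d′)       = t-app (renU-typed ρ h d) (renU-typed ρ h d′)
  renU-typed ρ h (t-box d)          = t-box (renU-typed ρ h d)
  renU-typed ρ h (t-letbox {As = As} {A = A} d d′) =
    t-letbox (renU-typed (liftR ρ) (lift-renames (As , A) h) d) (renU-typed ρ h d′)
  renU-typed ρ h (t-ext {X = X} e ds) = t-ext (h X e) (renU*-typed ρ h ds)
  renU*-typed ρ h t-nil         = t-nil
  renU*-typed ρ h (t-cons d ds) = t-cons (renU-typed ρ h d) (renU*-typed ρ h ds)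

  weakenU : ∀ {Δ Φ r A C} → Δ ∣ Φ ⊢ r ∶ A → (C ∷ Δ) ∣ Φ ⊢ renU suc r ∶ A
  weakenU = renU-typed suc (λ _ e → e)

  weakenA : ∀ {Δ Φ r A B} → Δ ∣ Φ ⊢ r ∶ A → Δ ∣ (B ∷ Φ) ⊢ renA suc r ∶ A
  weakenA = renA-typed suc (λ _ e → e)

  AtomSubst : MCtx → List Ty → List Ty → (ℕ → Tm) → Set
  AtomSubst Δ Φ Ψ σ = ∀ i {B} → nth Φ i ≡ just B → Δ ∣ Ψ ⊢ σ i ∶ B

  liftS-typed : ∀ {Δ Φ Ψ σ} A → AtomSubst Δ Φ Ψ σ → AtomSubst Δ (A ∷ Φ) (A ∷ Ψ) (liftS σ)
  liftS-typed A h zero    refl = t-hyp refl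
  liftS-typed A h (suc i) e    = weakenA (h i e)

  weakenU-subst : ∀ {Δ Φ Ψ σ} C → AtomSubst Δ Φ Ψ σ →
                  AtomSubst (C ∷ Δ) Φ Ψ (λ i → renU suc (σ i))
  weakenU-subst C h i e = weakenU (h i e)

  subA-typed  : ∀ {Δ Φ Ψ r A} σ → AtomSubst Δ Φ Ψ σ → Δ ∣ Φ ⊢ r ∶ A → Δ ∣ Ψ ⊢ subA σ r ∶ A
  subA*-typed : ∀ {Δ Φ Ψ rs As} σ → AtomSubst Δ Φ Ψ σ →
                Δ ∣ Φ ⊢* rs ∶ As → Δ ∣ Ψ ⊢* subA* σ rs ∶ As
  subA-typed σ h (t-hyp {i = i} e) = h i e
  subA-typed σ h (t-con c)         = t-con c
  subA-typed σ h t-top             = t-top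
  subA-typed σ h t-bot             = t-bot
  subA-typed σ h (t-isapp A)       = t-isapp A
  subA-typed σ h (t-lam {A = A} d) = t-lam (subA-typed (liftS σ) (liftS-typed A h) d)
  subA-typed σ h (t-app d d′)      = t-app (subA-typed σ h d) (subA-typed σ h d′)
  subA-typed σ h (t-box d)         = t-box d
  subA-typed {Φ = Φ} σ h (t-letbox {As = As} {A = A} d d′) =
    t-letbox (subA-typed _ (weakenU-subst {Φ = Φ} (As , A) h) d) (subA-typed σ h d′)
  subA-typed σ h (t-ext e ds)      = t-ext e (subA*-typed σ h ds)
  subA*-typed σ h t-nil         = t-nil
  subA*-typed σ h (t-cons d ds) = t-cons (subA-typed σ h d) (subA*-typed σ h ds)

  typed-arg : ∀ {Δ Φ ts As} → Δ ∣ Φ ⊢* ts ∶ As → ∀ i {B} → nth As i ≡ just B →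
              Σ Tm (λ t → nth ts i ≡ just t × Δ ∣ Φ ⊢ t ∶ B)
  typed-arg (t-cons d ds) zero    refl = _ , refl , d
  typed-arg (t-cons d ds) (suc i) e    = typed-arg ds i e

  argsSub-typed : ∀ {Δ Φ ts As} → Δ ∣ Φ ⊢* ts ∶ As → AtomSubst Δ As Φ (argsSub ts)
  argsSub-typed ds i e with typed-arg ds i e
  ... | t , lookup , d rewrite lookup = d

  data SubstEntry (Δ′ : MCtx) (X : ℕ) : Maybe Tm → List Ty × Ty → Set where
    kept     : ∀ {C} → nth Δ′ X ≡ just C → SubstEntry Δ′ X nothing C
    replaced : ∀ {Bs B b} → Δ′ ∣ Bs ⊢ b ∶ B → SubstEntry Δ′ X (just b) (Bs , B)

  UnknownSubst : MCtx → MCtx → (ℕ → Maybe Tm) → Set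
  UnknownSubst Δ Δ′ θ = ∀ X {C} → nth Δ X ≡ just C → SubstEntry Δ′ X (θ X) C

  weaken-entry : ∀ {Δ′ X m C C′} → SubstEntry Δ′ X m C →
                 SubstEntry (C′ ∷ Δ′) (suc X) (Maybe.map (renU suc) m) C
  weaken-entry (kept e)     = kept e
  weaken-entry (replaced d) = replaced (weakenU d)

  liftM-typed : ∀ {Δ Δ′ θ C} → UnknownSubst Δ Δ′ θ → UnknownSubst (C ∷ Δ) (C ∷ Δ′) (liftM θ)
  liftM-typed h zero    refl = kept refl
  liftM-typed h (suc X) e    = weaken-entry (h X e)

  mvarSub-typed : ∀ {Δ′ Φ X m As A ts} → SubstEntry Δ′ X m (As , A) →
                  Δ′ ∣ Φ ⊢* ts ∶ As → Δ′ ∣ Φ ⊢ mvarSub m X ts ∶ A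
  mvarSub-typed (kept e)     ds = t-ext e ds
  mvarSub-typed (replaced d) ds = subA-typed _ (argsSub-typed ds) d

  subU-typed  : ∀ {Δ Δ′ Φ r A} θ → UnknownSubst Δ Δ′ θ → Δ ∣ Φ ⊢ r ∶ A → Δ′ ∣ Φ ⊢ subU θ r ∶ A
  subU*-typed : ∀ {Δ Δ′ Φ rs As} θ → UnknownSubst Δ Δ′ θ →
                Δ ∣ Φ ⊢* rs ∶ As → Δ′ ∣ Φ ⊢* subU* θ rs ∶ As
  subU-typed θ h (t-hyp e)          = t-hyp e
  subU-typed θ h (t-con c)          = t-con c
  subU-typed θ h t-top              = t-top
  subU-typed θ h t-bot              = t-bot
  subU-typed θ h (t-isapp A)        = t-isapp A
  subU-typed θ h (t-lam d)          = t-lam (subU-typed θ h d)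
  subU-typed θ h (t-app d d′)       = t-app (subU-typed θ h d) (subU-typed θ h d′)
  subU-typed θ h (t-box d)          = t-box (subU-typed θ h d)
  subU-typed θ h (t-letbox d d′)    = t-letbox (subU-typed (liftM θ) (liftM-typed h) d) (subU-typed θ h d′)
  subU-typed θ h (t-ext {X = X} e ds) = mvarSub-typed (h X e) (subU*-typed θ h ds)
  subU*-typed θ h t-nil         = t-nil
  subU*-typed θ h (t-cons d ds) = t-cons (subU-typed θ h d) (subU*-typed θ h ds)

  TypedUnknowns : MCtx → List U → Set
  TypedUnknowns Δ δ = Pointwise (λ C u → proj₁ u ≡ box (proj₁ C) (proj₂ C)) Δ δ

  hdBody-entry : ∀ {X As A} (u : U) → proj₁ u ≡ box As A → SubstEntry [] X (hdBody u) (As , A)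
  hdBody-entry (box _ _ , ((b , t-box d) , f)) refl = replaced d

  ςX-typed : ∀ {Δ δ} → TypedUnknowns Δ δ → UnknownSubst Δ [] (ςX δ)
  ςX-typed p X e with lookup-pointwise X p e
  ... | u , lookup , hasType rewrite lookup = hdBody-entry u hasType

  toVals-typed : ∀ As xs → Pointwise (λ A u → proj₁ u ≡ A) As (toVals As xs)
  toVals-typed []       xs       = []
  toVals-typed (A ∷ As) (x , xs) = refl ∷ toVals-typed As xs

  module Evaluation (interp : (c : Const) → Sem (ctype c)) where
    open Denot interp

    evaluate  : ∀ {Δ Φ r A} (ς : Val) → Δ ∣ Φ ⊢ r ∶ A → Δ ∣ Φ ⊢ᵥ ς →
                Σ (Sem A) (λ v → ς ⊨ r ⇓ (A , v))
    evaluate* : ∀ {Δ Φ rs As} (ς : Val) → Δ ∣ Φ ⊢* rs ∶ As → Δ ∣ Φ ⊢ᵥ ς →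
                Σ (Sems As) (λ xs → ς ⊨* rs ⇓ As ∶ xs)
    evaluate ς (t-hyp {i = i} e) (pa , _) with lookup-pointwise i pa e
    ... | (A , v) , lookup , refl = v , ev-atom lookup
    evaluate ς (t-con c)   p = interp c , ev-con c
    evaluate ς t-top       p = _ , ev-top
    evaluate ς t-bot       p = _ , ev-bot
    evaluate ς (t-isapp A) p = _ , ev-isapp A
    evaluate (φ , δ) (t-lam {A = A} {B = B} {r = r} d) (pa , pu) =
      (λ x → proj₁ (body x)) , ev-lam (λ x → proj₂ (body x))
      where body : (x : Sem A) → Σ (Sem B) (λ v → ((A , x) ∷ φ , δ) ⊨ r ⇓ (B , v))
            body x = evaluate ((A , x) ∷ φ , δ) d (refl ∷ pa , pu)
    evaluate ς (t-app d d′) p with evaluate ς d p | evaluate ς d′ p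
    ... | f , ef | x , ex = f x , ev-app ef ex
    -- ([]I): the head r ς_𝕏 is a closed box by the substitution lemma, and the
    -- tail evaluates the body under every valuation of the box-bound atoms.
    evaluate (φ , δ) (t-box {As = As} {A = A} {r = r} d) (_ , pu) =
      ((subU (ςX δ) r , closed) , (λ xs → proj₁ (body xs))) , ev-box closed (λ xs → proj₂ (body xs))
      where closed : [] ∣ [] ⊢ box As (subU (ςX δ) r) ∶ box As A
            closed = t-box (subU-typed (ςX δ) (ςX-typed pu) d)
            body : (xs : Sems As) → Σ (Sem A) (λ v → (toVals As xs , δ) ⊨ r ⇓ (A , v))
            body xs = evaluate (toVals As xs , δ) d (toVals-typed As xs , pu)
    evaluate (φ , δ) (t-letbox {As = As} {A = A} d d′) (pa , pu) with evaluate (φ , δ) d′ (pa , pu)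
    ... | v , ev with evaluate (φ , (box As A , v) ∷ δ) d (pa , refl ∷ pu)
    ... | w , ew = w , ev-letbox ev ew
    evaluate (φ , δ) (t-ext {X = X} e ds) (pa , pu)
      with lookup-pointwise X pu e | evaluate* (φ , δ) ds (pa , pu)
    ... | (box _ _ , (h , f)) , lookup , refl | xs , exs = f xs , ev-ext lookup exs
    evaluate* ς t-nil p = tt , ev-nil
    evaluate* ς (t-cons d ds) p with evaluate ς d p | evaluate* ς ds p
    ... | x , ex | xs , exs = (x , xs) , ev-cons ex exs

theorem6p10 : (S : Signature) → let open Lang S in
    (interp : (c : Const) → Sem (ctype c)) → let open Denot interp in
    (Δ : MCtx) (Φ : List Ty) (r : Tm) (A : Ty) (ς : Val) →
    Δ ∣ Φ ⊢ r ∶ A → Δ ∣ Φ ⊢ᵥ ς → Σ (Sem A) (λ v → ς ⊨ r ⇓ (A , v))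
theorem6p10 S interp Δ Φ r A ς typed valid =
  Metatheory.Evaluation.evaluate S interp ς typed valid
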